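{- Let $T$ be a finite tree and $c\in\mathcal{C}^2_{\mathcal{MIN}}(T)$. A node $u$ of $T$ is a fixed node of $c$ if and only if $|N_t^{1-c(u)}(u)-N_t^{c(u)}(u)|\le N_f^{1-c(u)}(u)-N_f^{c(u)}(u)$, and a toggle node of $c$ if and only if $|N_f^{c(u)}(u)-N_f^{1-c(u)}(u)|<N_t^{c(u)}(u)-N_t^{1-c(u)}(u)$.
   Context: Colorings are maps $c:V\to\{0,1\}$; $N^i(v)$ is the set of neighbors of $v$ with color $i$. $\mathcal{MIN}(c)(v)=c(v)$ if $|N^{c(v)}(v)|\le|N^{1-c(v)}(v)|$, else $1-c(v)$ (simultaneous update). $\mathcal{C}^2_{\mathcal{MIN}}(T)$ is the set of colorings $c$ with $\mathcal{MIN}(c)\ne c$ and $\mathcal{MIN}(\mathcal{MIN}(c))=c$. A node $u$ is a fixed node of $c$ if $\mathcal{MIN}(c)(u)=c(u)$ and a toggle node otherwise. $N^i_f(u)$ (resp. $N^i_t(u)$) is the number of neighbors of $u$ with color $i$ under $c$ that are fixed (resp. toggle) nodes. -}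

module Defs where

open import Data.Nat using (ℕ; zero; suc; _+_; _≤ᵇ_; _≥_)
open import Data.Bool using (Bool; true; false; not; if_then_else_; _∧_; T)
open import Data.Fin using (Fin)
open import Data.List using (List; []; _∷_; map; length)
open import Data.Nat.ListAction using (sum)
open import Data.Unit using (⊤)
open import Data.Empty using (⊥)
open import Data.List.Relation.Unary.Unique.Propositional using (Unique)
open import Data.List.Relation.Unary.All using (All)
open import Data.Integer using (ℤ; +_; _⊖_; ∣_∣) renaming (_≤_ to _≤ℤ_; _<_ to _<ℤ_)
open import Data.Fin.Base using ()
open import Data.Product using (Σ; _×_; ∃)
open import Relation.Binary.PropositionalEquality using (_≡_)
open import Relation.Nullary using (¬_)
open import Data.List using (allFin)

record Graph (n : ℕ) : Set where
  field
    adj    : Fin n → Fin n → Bool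
    sym    : ∀ u v → adj u v ≡ adj v u
    irrefl : ∀ u → adj u u ≡ false
open Graph public

Chain : ∀ {n} → Graph n → List (Fin n) → Set
Chain G []             = ⊤
Chain G (x ∷ [])       = ⊤
Chain G (x ∷ y ∷ xs)   = T (adj G x y) × Chain G (y ∷ xs)

data StartsEnds {n} : List (Fin n) → Fin n → Fin n → Set where
  single : ∀ {u} → StartsEnds (u ∷ []) u u
  step   : ∀ {u w v xs} → StartsEnds (w ∷ xs) w v → StartsEnds (u ∷ w ∷ xs) u v

Connected : ∀ {n} → Graph n → Set
Connected {n} G = ∀ (u v : Fin n) → Σ (List (Fin n)) λ xs → StartsEnds xs u v × Chain G xs

lastOf : ∀ {n} → Fin n → List (Fin n) → Fin n
lastOf x []       = x
lastOf x (y ∷ ys) = lastOf y ys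

IsCycle : ∀ {n} → Graph n → List (Fin n) → Set
IsCycle G []       = ⊥
IsCycle G (x ∷ xs) = length xs ≥ 2 × Unique (x ∷ xs) × Chain G (x ∷ xs) × T (adj G (lastOf x xs) x)

Acyclic : ∀ {n} → Graph n → Set
Acyclic {n} G = ∀ (xs : List (Fin n)) → ¬ IsCycle G xs

IsTree : ∀ {n} → Graph n → Set
IsTree G = Connected G × Acyclic G

-- Colorings c : V → {0,1}, encoded with Bool (false = 0, true = 1; 1 - c(v) = not (c v)).
Coloring : ℕ → Set
Coloring n = Fin n → Bool

count : ∀ {n} → (Fin n → Bool) → ℕ
count {n} p = sum (map (λ v → if p v then 1 else 0) (allFin n))

_==ᵇ_ : Bool → Bool → Bool
true  ==ᵇ b = b
false ==ᵇ b = not b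

N : ∀ {n} → Graph n → Coloring n → Bool → Fin n → ℕ
N G c i v = count (λ w → adj G v w ∧ (c w ==ᵇ i))

MIN : ∀ {n} → Graph n → Coloring n → Coloring n
MIN G c v = if N G c (c v) v ≤ᵇ N G c (not (c v)) v then c v else not (c v)

InC2 : ∀ {n} → Graph n → Coloring n → Set
InC2 G c = ¬ (∀ v → MIN G c v ≡ c v) × (∀ v → MIN G (MIN G c) v ≡ c v)

FixedNode : ∀ {n} → Graph n → Coloring n → Fin n → Set
FixedNode G c u = MIN G c u ≡ c u

ToggleNode : ∀ {n} → Graph n → Coloring n → Fin n → Set
ToggleNode G c u = ¬ (MIN G c u ≡ c u)

isFixedᵇ : ∀ {n} → Graph n → Coloring n → Fin n → Bool
isFixedᵇ G c u = MIN G c u ==ᵇ c u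

Nf : ∀ {n} → Graph n → Coloring n → Bool → Fin n → ℕ
Nf G c i u = count (λ w → adj G u w ∧ (c w ==ᵇ i) ∧ isFixedᵇ G c w)

Nt : ∀ {n} → Graph n → Coloring n → Bool → Fin n → ℕ
Nt G c i u = count (λ w → adj G u w ∧ (c w ==ᵇ i) ∧ not (isFixedᵇ G c w))

{-# OPTIONS --safe #-}

-- Let fₛ, fₒ (tₛ, tₒ) count the fixed (toggle) neighbours of u of its own and of the
-- other colour. Under c, u has fₛ + tₛ neighbours of its own colour and fₒ + tₒ of the
-- other; under MIN(c) the toggle neighbours have swapped colour, giving fₛ + tₒ and
-- fₒ + tₛ. Because c has period two, u is fixed in c exactly when it is fixed in MIN(c),
-- so both comparisons go the same way, and the two inequalities together say
-- |tₒ − tₛ| ≤ fₒ − fₛ (fixed) or |fₛ − fₒ| < tₛ − tₒ (toggle). Only MIN(MIN(c)) = c is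
-- used.
module Submission where

open import Defs hiding (sym)
open import Data.Bool using (Bool; true; false; not; if_then_else_; _∧_; T)
open import Data.Bool.Properties using (not-¬; ¬-not)
open import Data.Empty using (⊥-elim)
open import Data.Fin using (Fin)
open import Data.Integer using (+_; _⊖_; ∣_∣; +≤+; +<+) renaming (_≤_ to _≤ℤ_; _<_ to _<ℤ_)
open import Data.Integer.Properties using ([1+m]⊖[1+n]≡m⊖n; ∣⊖∣-≤; ∣m⊖n∣≡∣n⊖m∣)
open import Data.List using (List; []; _∷_; map; allFin)
open import Data.List.Properties using (map-cong)
open import Data.Nat using (ℕ; zero; suc; _+_; _≤_; _<_; s≤s; s≤s⁻¹)
open import Data.Nat.ListAction using (sum)
open import Data.Nat.Properties
  using (+-comm; +-cancelˡ-≤; +-monoʳ-≤; m≤m+n; m+n∸m≡n; ≤ᵇ⇒≤; ≤⇒≤ᵇ;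
         ≰⇒>; <⇒≱; ≤-trans; m≤n⇒∃[o]m+o≡n; ≤-total; +-commutativeSemigroup)
open import Data.Product using (_×_; _,_; proj₂; swap)
open import Data.Unit using (tt)
open import Function using (_∘_; const)
open import Function.Bundles using (_⇔_; mk⇔; Equivalence)
open import Function.Properties.Equivalence using () renaming (refl to ⇔-refl; trans to ⇔-trans; sym to ⇔-sym)
open import Relation.Binary.Consequences using (wlog)
open import Relation.Nullary using (¬_)
open import Relation.Binary.PropositionalEquality
  using (_≡_; refl; sym; trans; cong; subst; subst₂)
open import Algebra.Properties.CommutativeSemigroup +-commutativeSemigroup using (interchange; x∙yz≈y∙xz)

open Equivalence

χ : Bool → ℕ
χ b = if b then 1 else 0

sum-map-+ : {A : Set} (f g : A → ℕ) (xs : List A) →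
            sum (map (λ x → f x + g x) xs) ≡ sum (map f xs) + sum (map g xs)
sum-map-+ f g []       = refl
sum-map-+ f g (x ∷ xs) = trans (cong (λ s → f x + g x + s) (sum-map-+ f g xs)) (interchange (f x) (g x) _ _)

count-split : ∀ {n} (p q r : Fin n → Bool) → (∀ v → χ (p v) ≡ χ (q v) + χ (r v)) →
              count p ≡ count q + count r
count-split {n} p q r χp≡χq+χr = trans (cong sum (map-cong χp≡χq+χr (allFin n)))
                                       (sum-map-+ (χ ∘ q) (χ ∘ r) (allFin n))

χ-∧-split : ∀ a e f → χ (a ∧ e) ≡ χ (a ∧ e ∧ f) + χ (a ∧ e ∧ not f)
χ-∧-split false e     f     = refl
χ-∧-split true  false f     = refl
χ-∧-split true  true  true  = refl
χ-∧-split true  true  false = refl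

-- m is the new colour of a vertex of old colour k: it has colour x afterwards iff it kept
-- colour x, or it changed from colour not x.
χ-recolour : ∀ a k m x → χ (a ∧ (m ==ᵇ x)) ≡ χ (a ∧ (k ==ᵇ x) ∧ (m ==ᵇ k)) + χ (a ∧ (k ==ᵇ not x) ∧ not (m ==ᵇ k))
χ-recolour false k     m     x     = refl
χ-recolour true  true  true  true  = refl
χ-recolour true  true  true  false = refl
χ-recolour true  true  false true  = refl
χ-recolour true  true  false false = refl
χ-recolour true  false true  true  = refl
χ-recolour true  false true  false = refl
χ-recolour true  false false true  = refl
χ-recolour true  false false false = refl

if-stays⇔ : ∀ b x → ((if b then x else not x) ≡ x) ⇔ T b
if-stays⇔ true  x = mk⇔ (const tt) (const refl)
if-stays⇔ false x = mk⇔ (λ notx≡x → ⊥-elim (not-¬ refl (sym notx≡x))) λ ()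

≤-≡⇔ : ∀ {a a′ b b′} → a ≡ a′ → b ≡ b′ → (a ≤ b ⇔ a′ ≤ b′)
≤-≡⇔ refl refl = ⇔-refl

+m≤n⊖o⇔o+m≤n : ∀ m n o → (+ m ≤ℤ n ⊖ o) ⇔ o + m ≤ n
+m≤n⊖o⇔o+m≤n m n       zero    = mk⇔ (λ { (+≤+ m≤n) → m≤n }) +≤+
+m≤n⊖o⇔o+m≤n m zero    (suc o) = mk⇔ (λ ()) (λ ())
+m≤n⊖o⇔o+m≤n m (suc n) (suc o) rewrite [1+m]⊖[1+n]≡m⊖n n o =
  ⇔-trans (+m≤n⊖o⇔o+m≤n m n o) (mk⇔ s≤s s≤s⁻¹)

+m<n⊖o⇔o+m<n : ∀ m n o → (+ m <ℤ n ⊖ o) ⇔ o + m < n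
+m<n⊖o⇔o+m<n m n       zero    = mk⇔ (λ { (+<+ m<n) → m<n }) +<+
+m<n⊖o⇔o+m<n m zero    (suc o) = mk⇔ (λ ()) (λ ())
+m<n⊖o⇔o+m<n m (suc n) (suc o) rewrite [1+m]⊖[1+n]≡m⊖n n o =
  ⇔-trans (+m<n⊖o⇔o+m<n m n o) (mk⇔ s≤s s≤s⁻¹)

∣m⊖m+n∣≡n : ∀ m n → ∣ m ⊖ (m + n) ∣ ≡ n
∣m⊖m+n∣≡n m n = trans (∣⊖∣-≤ (m≤m+n m n)) (m+n∸m≡n m n)

+-≤-both-shifted⇔ : ∀ a b x d → (a + x ≤ b + (x + d) × a + (x + d) ≤ b + x) ⇔ a + d ≤ b
+-≤-both-shifted⇔ a b x d = mk⇔
  (λ (_ , a+x+d≤b+x) → +-cancelˡ-≤ x _ _ (subst₂ _≤_ (x∙yz≈y∙xz a x d) (+-comm b x) a+x+d≤b+x))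
  (λ a+d≤b → ≤-trans (+-monoʳ-≤ a x≤x+d) (≤-trans (shifted a+d≤b) (+-monoʳ-≤ b x≤x+d)) , shifted a+d≤b)
  where
  x≤x+d : x ≤ x + d
  x≤x+d = m≤m+n x d

  shifted : a + d ≤ b → a + (x + d) ≤ b + x
  shifted a+d≤b = subst₂ _≤_ (sym (x∙yz≈y∙xz a x d)) (+-comm x b) (+-monoʳ-≤ x a+d≤b)

+-≤-both⇔+∣⊖∣≤ : ∀ a b x y → (a + x ≤ b + y × a + y ≤ b + x) ⇔ a + ∣ x ⊖ y ∣ ≤ b
+-≤-both⇔+∣⊖∣≤ a b = wlog ≤-total symmetric ordered
  where
  Q : ℕ → ℕ → Set
  Q x y = (a + x ≤ b + y × a + y ≤ b + x) ⇔ a + ∣ x ⊖ y ∣ ≤ b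

  symmetric : ∀ {x y} → Q x y → Q y x
  symmetric {x} {y} Qxy = mk⇔ (subst (λ k → a + k ≤ b) (∣m⊖n∣≡∣n⊖m∣ x y) ∘ to Qxy ∘ swap)
                              (swap ∘ from Qxy ∘ subst (λ k → a + k ≤ b) (∣m⊖n∣≡∣n⊖m∣ y x))

  ordered : ∀ x y → x ≤ y → Q x y
  ordered x y x≤y with m≤n⇒∃[o]m+o≡n x≤y
  ... | d , refl rewrite ∣m⊖m+n∣≡n x d = +-≤-both-shifted⇔ a b x d

module _ {n} (G : Graph n) (c : Coloring n) where

  N≡Nf+Nt : ∀ x u → N G c x u ≡ Nf G c x u + Nt G c x u
  N≡Nf+Nt x u = count-split _ _ _ λ w → χ-∧-split (adj G u w) (c w ==ᵇ x) (isFixedᵇ G c w)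

  N∘MIN≡Nf+Nt : ∀ x u → N G (MIN G c) x u ≡ Nf G c x u + Nt G c (not x) u
  N∘MIN≡Nf+Nt x u = count-split _ _ _ λ w → χ-recolour (adj G u w) (c w) (MIN G c w) x

  N∘MIN≡Nf+Nt-not : ∀ x u → N G (MIN G c) (not x) u ≡ Nf G c (not x) u + Nt G c x u
  N∘MIN≡Nf+Nt-not true  = N∘MIN≡Nf+Nt false
  N∘MIN≡Nf+Nt-not false = N∘MIN≡Nf+Nt true

  MIN-stays⇔ : ∀ {v x} → c v ≡ x → (MIN G c v ≡ c v ⇔ N G c x v ≤ N G c (not x) v)
  MIN-stays⇔ {v} refl = ⇔-trans (if-stays⇔ _ (c v)) (mk⇔ (≤ᵇ⇒≤ _ _) ≤⇒≤ᵇ)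

  MIN-stays⇔-not : ∀ {v x} → c v ≡ not x → (MIN G c v ≡ c v ⇔ N G c (not x) v ≤ N G c x v)
  MIN-stays⇔-not {x = true}  = MIN-stays⇔
  MIN-stays⇔-not {x = false} = MIN-stays⇔

module TwoPeriodic {n} (G : Graph n) (c : Coloring n) (u : Fin n)
               (period : MIN G (MIN G c) u ≡ c u) where

  private
    c′ : Coloring n
    c′ = MIN G c

  fₛ fₒ tₛ tₒ : ℕ
  fₛ = Nf G c (c u) u
  fₒ = Nf G c (not (c u)) u
  tₛ = Nt G c (c u) u
  tₒ = Nt G c (not (c u)) u

  stays⇔ : FixedNode G c u ⇔ fₛ + tₛ ≤ fₒ + tₒ
  stays⇔ = ⇔-trans (MIN-stays⇔ G c refl) (≤-≡⇔ (N≡Nf+Nt G c _ u) (N≡Nf+Nt G c _ u))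

  fixed⇔fixed-after-MIN : FixedNode G c u ⇔ FixedNode G c′ u
  fixed⇔fixed-after-MIN = mk⇔ (λ c′u≡cu → trans period (sym c′u≡cu))
                              (λ c″u≡c′u → sym (trans (sym period) c″u≡c′u))

  stays-after-MIN⇔ : c′ u ≡ c u → (FixedNode G c′ u ⇔ fₛ + tₒ ≤ fₒ + tₛ)
  stays-after-MIN⇔ c′u≡cu = ⇔-trans (MIN-stays⇔ G c′ c′u≡cu)
                                    (≤-≡⇔ (N∘MIN≡Nf+Nt G c _ u) (N∘MIN≡Nf+Nt-not G c _ u))

  flips-after-MIN⇔ : c′ u ≡ not (c u) → (FixedNode G c′ u ⇔ fₒ + tₛ ≤ fₛ + tₒ)
  flips-after-MIN⇔ c′u≡notcu = ⇔-trans (MIN-stays⇔-not G c′ c′u≡notcu)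
                                       (≤-≡⇔ (N∘MIN≡Nf+Nt-not G c _ u) (N∘MIN≡Nf+Nt G c _ u))

  fixed⇔ : FixedNode G c u ⇔ (fₛ + tₒ ≤ fₒ + tₛ × fₛ + tₛ ≤ fₒ + tₒ)
  fixed⇔ = mk⇔ (λ fixed → to (stays-after-MIN⇔ fixed) (to fixed⇔fixed-after-MIN fixed) , to stays⇔ fixed)
               (from stays⇔ ∘ proj₂)

  toggle⇔ : ToggleNode G c u ⇔ (tₒ + fₛ < tₛ + fₒ × tₒ + fₒ < tₛ + fₛ)
  toggle⇔ = mk⇔
    (λ toggle → commute fₒ fₛ tₛ tₒ (≰⇒> (toggle′ toggle)) , commute fₛ fₒ tₛ tₒ (≰⇒> (toggle ∘ from stays⇔)))
    (λ (_ , fewer-other) fixed → <⇒≱ fewer-other (to (≤-≡⇔ (+-comm fₛ tₛ) (+-comm fₒ tₒ)) (to stays⇔ fixed)))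
    where
    commute : ∀ a b x y → b + y < a + x → y + b < x + a
    commute a b x y = subst₂ _<_ (+-comm b y) (+-comm a x)

    toggle′ : ToggleNode G c u → ¬ (fₒ + tₛ ≤ fₛ + tₒ)
    toggle′ toggle = toggle ∘ from fixed⇔fixed-after-MIN ∘ from (flips-after-MIN⇔ (¬-not toggle))

lemma10 : (n : ℕ) (T : Graph n) → IsTree T → (c : Coloring n) → InC2 T c → (u : Fin n) →
            (FixedNode T c u ⇔ (+ ∣ Nt T c (not (c u)) u ⊖ Nt T c (c u) u ∣ ≤ℤ Nf T c (not (c u)) u ⊖ Nf T c (c u) u))
            × (ToggleNode T c u ⇔ (+ ∣ Nf T c (c u) u ⊖ Nf T c (not (c u)) u ∣ <ℤ Nt T c (c u) u ⊖ Nt T c (not (c u)) u))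
lemma10 n T _ c (_ , period) u =
  ⇔-trans fixed⇔ (⇔-trans (+-≤-both⇔+∣⊖∣≤ fₛ fₒ tₒ tₛ) (⇔-sym (+m≤n⊖o⇔o+m≤n _ fₒ fₛ))) ,
  -- the strict case is the non-strict one with a = suc tₒ, as tₒ + k < tₛ unfolds to suc tₒ + k ≤ tₛ
  ⇔-trans toggle⇔ (⇔-trans (+-≤-both⇔+∣⊖∣≤ (suc tₒ) tₛ fₛ fₒ) (⇔-sym (+m<n⊖o⇔o+m<n _ tₛ tₒ)))
  where open TwoPeriodic T c u (period u)
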